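{- Let $T^{\natural}=(S^{\natural},I^{\natural},R^{\natural},V^{\natural})$ be an infinite-state transition system with $V^{\natural}=V^{\natural}_{bool}\cup V^{\natural}_{int}$, let $\varphi=\{\varphi_1,\dots,\varphi_n\}$ be a set of predicates with $V(\varphi)\subseteq V^{\natural}_{int}$, and let $T^{\sharp}=(S^{\sharp},I^{\sharp},R^{\sharp},V^{\sharp})$ be the partially predicate abstracted transition system: $V^{\sharp}=(V^{\natural}\cup\{b_1,\dots,b_n\})\setminus V(\varphi)$, $S^{\sharp}=\bigcup_{s\in S^{\natural}}\alpha(s)$, $I^{\sharp}=\bigcup_{s\in I^{\natural}}\alpha(s)$, $R^{\sharp}=\bigcup_{r\in R^{\natural}}\alpha^{\tau}(r)$. Let $T^{\sharp}_{RS}=\big((\mu Z.\,I^{\sharp}\vee post[R^{\sharp}](Z))^{+},I^{\sharp},R^{\sharp},V^{\sharp}\big)$. Then for every ACTL formula $f^{\sharp}$ over $V^{\sharp}$, if $I^{\sharp}\subseteq\llbracket f^{\sharp}\rrbracket^{ - }_{T^{\sharp}_{RS}}$ then $T^{\natural}\models\gamma(f^{\sharp})$.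
   Context: A transition system $T=(S,I,R,V)$ has $S\subseteq\mathcal{B}^{|V_{bool}|}\times\mathcal{Z}^{|V_{int}|}$, $I\subseteq S$, $R\subseteq S\times S$; $T\models f$ means every initial state satisfies the CTL formula $f$; ACTL is the universal fragment of CTL. $post[R](A)=\{b\mid a\in A\wedge(a,b)\in R\}$. $b_1,\dots,b_n$ are fresh boolean variables; $\varphi_i'$ is $\varphi_i$ with variables primed. $\alpha(s)=\exists V(\varphi).(s\wedge\bigwedge_i(\varphi_i\iff b_i))$; $\alpha^{\tau}(r)=\exists V(\varphi).\exists V(\varphi').(r\wedge CS\wedge\bigwedge_i(\varphi_i\iff b_i)\wedge\bigwedge_i(\varphi_i'\iff b_i'))$ with $CS=\bigwedge_i((\bigwedge_{v\in V(\varphi_i)}v'=v)\implies(b_i'\iff b_i))$. $\gamma(f^{\sharp})$ is obtained by replacing every atomic subformula $a$ of $f^{\sharp}$ by $a[\bar\varphi/\bar b]$ (each $b_i$ replaced by $\varphi_i$). $(\mu Z.\,I^{\sharp}\vee post[R^{\sharp}](Z))^{+}$ denotes an over-approximation (a superset) of the set of states reachable from $I^{\sharp}$ via $R^{\sharp}$, computed e.g. with a widening operator; $T^{\sharp}_{RS}$ is $T^{\sharp}$ with its state space restricted to this set. $\llbracket f\rrbracket^{ - }_{T}$ denotes an under-approximation (a subset) of the set $\llbracket f\rrbracket_T$ of states of $T$ satisfying $f$, obtained by approximating the fixpoint computations of the temporal operators (dual widening for greatest fixpoints, early termination for least fixpoints, recursively with over-approximations under negation). -}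

module Defs where

open import Data.Nat using (ℕ; zero; suc; _<_)
open import Data.Fin using (Fin)
open import Data.Bool using (Bool; true)
open import Data.Integer using (ℤ)
open import Data.Product using (Σ; ∃; _×_; _,_; proj₁; proj₂)
open import Data.Sum using (_⊎_)
open import Relation.Binary.PropositionalEquality using (_≡_; refl; subst; sym)
open import Relation.Nullary using (¬_)

record TS (St : Set) : Set₁ where
  field
    S : St → Set
    I : St → Set
    R : St → St → Set
    I⊆S : ∀ {s} → I s → S s
    R⊆S×S : ∀ {s s′} → R s s′ → S s × S s′

-- ACTL (universal fragment of CTL, negation normal form).
-- Atomic propositions are arbitrary predicates on states (negated atoms
-- are again atoms).

data ACTL (St : Set) : Set₁ where
  atom : (St → Set) → ACTL St
  _∧_  : ACTL St → ACTL St → ACTL St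
  _∨_  : ACTL St → ACTL St → ACTL St
  AX   : ACTL St → ACTL St
  AG   : ACTL St → ACTL St
  AF   : ACTL St → ACTL St
  AU   : ACTL St → ACTL St → ACTL St
  AR   : ACTL St → ACTL St → ACTL St

Path : {St : Set} → TS St → St → Set
Path {St} T s = Σ (ℕ → St) λ π → (π 0 ≡ s) × (∀ i → TS.R T (π i) (π (suc i)))

sat : {St : Set} → TS St → St → ACTL St → Set
sat T s (atom p) = p s
sat T s (f ∧ g) = sat T s f × sat T s g
sat T s (f ∨ g) = sat T s f ⊎ sat T s g
sat T s (AX f) = ∀ s′ → TS.R T s s′ → sat T s′ f
sat T s (AG f) = (π : Path T s) → ∀ i → sat T (proj₁ π i) f
sat T s (AF f) = (π : Path T s) → ∃ λ i → sat T (proj₁ π i) f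
sat T s (AU f g) = (π : Path T s) →
  ∃ λ k → sat T (proj₁ π k) g × (∀ j → j < k → sat T (proj₁ π j) f)
sat T s (AR f g) = (π : Path T s) →
  ∀ k → sat T (proj₁ π k) g ⊎ (∃ λ j → j < k × sat T (proj₁ π j) f)

⟦_⟧ : {St : Set} → ACTL St → TS St → St → Set
⟦ f ⟧ T s = TS.S T s × sat T s f

_⊨_ : {St : Set} → TS St → ACTL St → Set
T ⊨ f = ∀ s → TS.I T s → sat T s f

-- post[R](Z), and μZ. I ∨ post[R](Z) as an inductive set
data Reach {St : Set} (I : St → Set) (R : St → St → Set) : St → Set where
  init : ∀ {s} → I s → Reach I R s
  step : ∀ {s s′} → Reach I R s → R s s′ → Reach I R s′

CState : ℕ → ℕ → Set
CState nb ni = (Fin nb → Bool) × (Fin ni → ℤ)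

bools : ∀ {nb ni} → CState nb ni → Fin nb → Bool
bools = proj₁

ints : ∀ {nb ni} → CState nb ni → Fin ni → ℤ
ints = proj₂

-- A set of n predicates φ₁..φₙ over the integer variables.
-- vars i v ≡ true  means  v ∈ V(φ_i); φ_i only depends on V(φ_i).
record Preds (ni n : ℕ) : Set where
  field
    φ     : Fin n → (Fin ni → ℤ) → Bool
    vars  : Fin n → Fin ni → Bool
    local : ∀ i (ρ ρ′ : Fin ni → ℤ) →
            (∀ v → vars i v ≡ true → ρ v ≡ ρ′ v) → φ i ρ ≡ φ i ρ′

module _ {ni n : ℕ} (P : Preds ni n) where
  open Preds P

  InVφ : Fin ni → Set
  InVφ v = ∃ λ i → vars i v ≡ true

  Kept : Set
  Kept = Σ (Fin ni) λ v → ¬ InVφ v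

  -- abstract states: valuations of V♯ = (V ∪ {b₁..bₙ}) ∖ V(φ):
  -- booleans of V, the fresh b's, and the kept integer variables
  AState : ℕ → Set
  AState nb = (Fin nb → Bool) × (Fin n → Bool) × (Kept → ℤ)

  bvals : ∀ {nb} → AState nb → Fin n → Bool
  bvals a = proj₁ (proj₂ a)

  abs : ∀ {nb} → CState nb ni → AState nb
  abs s = bools s , (λ i → φ i (ints s)) , (λ k → ints s (proj₁ k))

  -- α(s) = ∃V(φ). (s ∧ ⋀ᵢ (φᵢ ⇔ bᵢ))   (a singleton set)
  α : ∀ {nb} → CState nb ni → AState nb → Set
  α s a = a ≡ abs s

  CS : ∀ {nb} → CState nb ni → CState nb ni → AState nb → AState nb → Set
  CS s s′ a a′ = ∀ i → (∀ v → vars i v ≡ true → ints s′ v ≡ ints s v) →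
                 bvals a′ i ≡ bvals a i

  ατ : ∀ {nb} → CState nb ni → CState nb ni → AState nb → AState nb → Set
  ατ s s′ a a′ = α s a × α s′ a′ × CS s s′ a a′

  module _ {nb : ℕ} (T : TS (CState nb ni)) where
    open TS T

    S♯ : AState nb → Set
    S♯ a = ∃ λ s → S s × α s a

    I♯ : AState nb → Set
    I♯ a = ∃ λ s → I s × α s a

    R♯ : AState nb → AState nb → Set
    R♯ a a′ = ∃ λ s → ∃ λ s′ → R s s′ × ατ s s′ a a′

    T♯ : TS (AState nb)
    T♯ = record
      { S = S♯ ; I = I♯ ; R = R♯
      ; I⊆S = λ { (s , i , e) → s , I⊆S i , e }
      ; R⊆S×S = λ { (s , s′ , r , e , e′ , _) →
                     (s , proj₁ (R⊆S×S r) , e) , (s′ , proj₂ (R⊆S×S r) , e′) } }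

    -- T♯_RS : state space restricted to an over-approximation Z of the
    -- reachable states (μZ. I♯ ∨ post[R♯](Z))⁺
    T♯RS : (Z : AState nb → Set) →
           (∀ a → Reach (TS.I T♯) (TS.R T♯) a → Z a) → TS (AState nb)
    T♯RS Z over = record
      { S = Z ; I = TS.I T♯
      ; R = λ a a′ → Z a × Z a′ × TS.R T♯ a a′
      ; I⊆S = λ {a} i → over a (init i)
      ; R⊆S×S = λ { (z , z′ , _) → z , z′ } }

  -- γ(f♯): replace each bᵢ in atoms by φᵢ
  γ : ∀ {nb} → ACTL (AState nb) → ACTL (CState nb ni)
  γ (atom p) = atom (λ s → p (abs s))
  γ (f ∧ g) = γ f ∧ γ g
  γ (f ∨ g) = γ f ∨ γ g
  γ (AX f) = AX (γ f)
  γ (AG f) = AG (γ f)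
  γ (AF f) = AF (γ f)
  γ (AU f g) = AU (γ f) (γ g)
  γ (AR f g) = AR (γ f) (γ g)

module Submission where

open import Defs
open import Data.Nat using (zero; suc)
open import Data.Product using (_,_; proj₁; proj₂)
open import Data.Sum using (inj₁; inj₂)
open import Relation.Binary.PropositionalEquality using (_≡_; refl; cong; cong₂)

-- The abstraction map s ↦ α(s) is a simulation of T by T♯_RS on concrete states
-- whose abstraction is reachable in T♯; ACTL formulas are reflected along any
-- simulation, and the hypothesis makes f♯ hold in the abstractions of the
-- initial states, which are reachable by construction.

comap : {St St′ : Set} → (St → St′) → ACTL St′ → ACTL St
comap h (atom p) = atom (λ s → p (h s))
comap h (f ∧ g)  = comap h f ∧ comap h g
comap h (f ∨ g)  = comap h f ∨ comap h g
comap h (AX f)   = AX (comap h f)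
comap h (AG f)   = AG (comap h f)
comap h (AF f)   = AF (comap h f)
comap h (AU f g) = AU (comap h f) (comap h g)
comap h (AR f g) = AR (comap h f) (comap h g)

record Simulation {St St′ : Set} (C : TS St) (A : TS St′) : Set₁ where
  field
    h        : St → St′
    Inv      : St → Set
    Inv-step : ∀ {s s′} → Inv s → TS.R C s s′ → Inv s′
    R-step   : ∀ {s s′} → Inv s → TS.R C s s′ → TS.R A (h s) (h s′)

module _ {St St′ : Set} {C : TS St} {A : TS St′} (sm : Simulation C A) where
  open Simulation sm

  Inv-path : ∀ {s} → Inv s → (π : Path C s) → ∀ i → Inv (proj₁ π i)
  Inv-path inv (_ , refl , _) zero    = inv
  Inv-path inv π@(_ , _ , t) (suc i) = Inv-step (Inv-path inv π i) (t i)

  map-path : ∀ {s} → Inv s → Path C s → Path A (h s)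
  map-path inv π@(ρ , ρ0 , t) =
    (λ i → h (ρ i)) , cong h ρ0 , λ i → R-step (Inv-path inv π i) (t i)

  sat-reflect : ∀ f {s} → Inv s → sat A (h s) f → sat C s (comap h f)
  sat-reflect (atom p) inv x = x
  sat-reflect (f ∧ g)  inv (x , y) = sat-reflect f inv x , sat-reflect g inv y
  sat-reflect (f ∨ g)  inv (inj₁ x) = inj₁ (sat-reflect f inv x)
  sat-reflect (f ∨ g)  inv (inj₂ y) = inj₂ (sat-reflect g inv y)
  sat-reflect (AX f)   inv x s′ r =
    sat-reflect f (Inv-step inv r) (x (h s′) (R-step inv r))
  sat-reflect (AG f)   inv x π i =
    sat-reflect f (Inv-path inv π i) (x (map-path inv π) i)
  sat-reflect (AF f)   inv x π with x (map-path inv π)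
  ... | i , y = i , sat-reflect f (Inv-path inv π i) y
  sat-reflect (AU f g) inv x π with x (map-path inv π)
  ... | k , y , z = k , sat-reflect g (Inv-path inv π k) y ,
                    λ j j<k → sat-reflect f (Inv-path inv π j) (z j j<k)
  sat-reflect (AR f g) inv x π k with x (map-path inv π) k
  ... | inj₁ y = inj₁ (sat-reflect g (Inv-path inv π k) y)
  ... | inj₂ (j , j<k , y) = inj₂ (j , j<k , sat-reflect f (Inv-path inv π j) y)

module _ {nb ni n} (T : TS (CState nb ni)) (P : Preds ni n) where

  Reachable♯ : AState P nb → Set
  Reachable♯ = Reach (TS.I (T♯ P T)) (TS.R (T♯ P T))

  γ≡comap-abs : (f : ACTL (AState P nb)) → γ P f ≡ comap (abs P) f
  γ≡comap-abs (atom p) = refl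
  γ≡comap-abs (f ∧ g)  = cong₂ _∧_ (γ≡comap-abs f) (γ≡comap-abs g)
  γ≡comap-abs (f ∨ g)  = cong₂ _∨_ (γ≡comap-abs f) (γ≡comap-abs g)
  γ≡comap-abs (AX f)   = cong AX (γ≡comap-abs f)
  γ≡comap-abs (AG f)   = cong AG (γ≡comap-abs f)
  γ≡comap-abs (AF f)   = cong AF (γ≡comap-abs f)
  γ≡comap-abs (AU f g) = cong₂ AU (γ≡comap-abs f) (γ≡comap-abs g)
  γ≡comap-abs (AR f g) = cong₂ AR (γ≡comap-abs f) (γ≡comap-abs g)

  -- CS holds because each φᵢ depends only on V(φᵢ).
  abs-R♯ : ∀ {s s′} → TS.R T s s′ → TS.R (T♯ P T) (abs P s) (abs P s′)
  abs-R♯ {s} {s′} r =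
    s , s′ , r , refl , refl , λ i agree → Preds.local P i (ints s′) (ints s) agree

  abs-simulation : (Z : AState P nb → Set) (over : ∀ a → Reachable♯ a → Z a) →
                   Simulation T (T♯RS P T Z over)
  abs-simulation Z over = record
    { h        = abs P
    ; Inv      = λ s → Reachable♯ (abs P s)
    ; Inv-step = λ reach r → step reach (abs-R♯ r)
    ; R-step   = λ reach r →
        over _ reach , over _ (step reach (abs-R♯ r)) , abs-R♯ r
    }

theorem1 : ∀ {nb ni n} (T : TS (CState nb ni)) (P : Preds ni n)
           (Z : AState P nb → Set)
           (over : ∀ a → Reach (TS.I (T♯ P T)) (TS.R (T♯ P T)) a → Z a)
           (f : ACTL (AState P nb))
           (U : AState P nb → Set)
           (under : ∀ a → U a → ⟦ f ⟧ (T♯RS P T Z over) a) →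
           (∀ a → TS.I (T♯ P T) a → U a) →
           T ⊨ γ P f
theorem1 T P Z over f U under I♯⊆U s i
  rewrite γ≡comap-abs T P f =
  sat-reflect (abs-simulation T P Z over) f reachable (proj₂ (under _ (I♯⊆U _ I♯-abs)))
  where
  I♯-abs : TS.I (T♯ P T) (abs P s)
  I♯-abs = s , i , refl
  reachable : Reachable♯ T P (abs P s)
  reachable = init I♯-abs
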